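{- For all integers $n\ge m\ge 3$, $\mathrm{opt}^{S}_{B}(G_{n,m}) \ge \gamma(G_{n-2,m-2})$.
   Context: $G_{n,m}$ is the rectangular grid with $n$ rows and $m$ columns, squares $(i,j)$, $1\le i\le n$, $1\le j\le m$. Some squares are occupied by blocks; a robot starts on $(1,1)$ (free). A move: choose one of the four directions; the robot slides and stops on the last free square before it would enter a block or leave the grid. A set of blocks is a solution of the block/stop game if for every free square $(i,j)$ there is a sequence of moves from $(1,1)$ after which the robot stands (stopped) on $(i,j)$. $\mathrm{opt}^{S}_{B}(G_{n,m})$ is the minimum number of blocks in such a solution. $\gamma(G_{n-2,m-2})$ is the domination number of the $(n-2)\times(m-2)$ grid graph (minimum size of a vertex set such that every other vertex is adjacent to one of its vertices). -}

module Defs where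

open import Data.Nat using (ℕ; zero; suc; _+_; _<_; _≤_)
open import Data.Fin using (Fin; toℕ; fromℕ<)
open import Data.List using (List; map; allFin)
open import Data.Nat.ListAction using (sum)
open import Data.Empty using (⊥)
open import Data.Bool using (Bool; true; false; if_then_else_)
open import Data.Maybe using (Maybe; just; nothing)
open import Data.Product using (Σ; _×_; _,_; ∃)
open import Data.Sum using (_⊎_)
open import Relation.Binary.PropositionalEquality using (_≡_)

-- Squares are 0-based here: paper square (i,j) is (i-1, j-1); (1,1) is (0,0).
-- A block configuration on the n×m grid: B r c ≡ true iff square (r,c) holds a block.
Config : ℕ → ℕ → Set
Config n m = Fin n → Fin m → Bool

count : ∀ {n m} → (Fin n → Fin m → Bool) → ℕ
count {n} {m} B = sum (map (λ i → sum (map (λ j → if B i j then 1 else 0) (allFin m))) (allFin n))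

Pos : Set
Pos = ℕ × ℕ

Free : ∀ {n m} → Config n m → Pos → Set
Free {n} {m} B (i , j) = Σ (i < n) λ p → Σ (j < m) λ q → B (fromℕ< p) (fromℕ< q) ≡ false

data Dir : Set where
  up down left right : Dir

next : Dir → Pos → Maybe Pos
next up    (zero  , j) = nothing
next up    (suc i , j) = just (i , j)
next down  (i , j)     = just (suc i , j)
next left  (i , zero)  = nothing
next left  (i , suc j) = just (i , j)
next right (i , j)     = just (i , suc j)

NextFree : ∀ {n m} → Config n m → Dir → Pos → Pos → Set
NextFree B d p p' = (next d p ≡ just p') × Free B p'

Stuck : ∀ {n m} → Config n m → Dir → Pos → Set
Stuck B d p = ∀ p' → next d p ≡ just p' → Free B p' → ⊥

data Slide {n m : ℕ} (B : Config n m) (d : Dir) : Pos → Pos → Set where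
  stop : ∀ {p} → Stuck B d p → Slide B d p p
  step : ∀ {p p' q} → NextFree B d p p' → Slide B d p' q → Slide B d p q

data Reach {n m : ℕ} (B : Config n m) : Pos → Set where
  start : Reach B (0 , 0)
  move  : ∀ {p q} (d : Dir) → Reach B p → Slide B d p q → Reach B q

IsSolution : ∀ n m → Config n m → Set
IsSolution n m B = Free B (0 , 0) × (∀ p → Free B p → Reach B p)

IsOptBS : ℕ → ℕ → ℕ → Set
IsOptBS n m k =
  (Σ (Config n m) λ B → IsSolution n m B × count B ≡ k) ×
  (∀ B → IsSolution n m B → k ≤ count B)

GridAdj : ∀ {a b} → Fin a × Fin b → Fin a × Fin b → Set
GridAdj (i , j) (i' , j') =
  ((toℕ i ≡ toℕ i') × ((toℕ j ≡ suc (toℕ j')) ⊎ (suc (toℕ j) ≡ toℕ j'))) ⊎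
  ((toℕ j ≡ toℕ j') × ((toℕ i ≡ suc (toℕ i')) ⊎ (suc (toℕ i) ≡ toℕ i')))

IsDominating : ∀ a b → (Fin a → Fin b → Bool) → Set
IsDominating a b D = ∀ (i : Fin a) (j : Fin b) →
  (D i j ≡ true) ⊎ (Σ (Fin a) λ i' → Σ (Fin b) λ j' → D i' j' ≡ true × GridAdj (i' , j') (i , j))

IsDominationNumber : ℕ → ℕ → ℕ → Set
IsDominationNumber a b g =
  (Σ (Fin a → Fin b → Bool) λ D → IsDominating a b D × count D ≡ g) ×
  (∀ D → IsDominating a b D → g ≤ count D)

-- Let B be a solution on the n×m grid, n = a+3, m = b+3. Every interior
-- square (x+1, y+1) has a block in its closed neighbourhood: either it is a
-- block itself, or it is free, hence reachable, and the robot can only stop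
-- there because the neighbouring square in the direction of its last move is
-- blocked (an interior square has all four neighbours inside the grid).
-- Projecting every square (r, c) to the interior grid by the clamp
-- r ↦ min(r-1, a), c ↦ min(c-1, b) maps the closed neighbourhood of
-- (x+1, y+1) into the closed neighbourhood of (x, y), so the image of the
-- blocks is a dominating set of G_{a+1,b+1}; and an image has at most as many
-- elements as the set it comes from.

module Submission where

open import Defs
open import Data.Nat using (ℕ; _≤_; _∸_)
open import Data.Nat using (zero; suc; _+_; _<_; _⊓_; pred; z≤n; s≤s; _≤?_)
open import Data.Nat.Properties
  using ( +-0-commutativeMonoid; +-identityʳ; +-mono-≤; m≤m+n; n≤1+n
        ; ≤-refl; ≤-trans; ≤-reflexive; ≤-antisym; ≤-pred; ≰⇒>
        ; m⊓n≤n; m≤n⇒m⊓n≡m; m≥n⇒m⊓n≡n; module ≤-Reasoning )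
import Data.Nat.ListAction as List
open import Data.Fin using (Fin; zero; suc; toℕ; fromℕ<; _≟_; punchIn)
open import Data.Fin.Properties using (toℕ<n; toℕ-fromℕ<; toℕ-injective; punchInᵢ≢i)
open import Data.List using (map; allFin; tabulate)
open import Data.List.Properties using (map-tabulate)
open import Data.Bool using (Bool; true; false; if_then_else_)
open import Data.Maybe using (just)
open import Data.Product using (Σ; _×_; _,_; proj₁; proj₂)
open import Data.Sum using (_⊎_; inj₁; inj₂)
open import Function using (_∘_; id)
open import Relation.Nullary using (does; yes; no; ¬_)
open import Relation.Nullary.Decidable using (dec-true; dec-false)
open import Relation.Binary.PropositionalEquality
  using (_≡_; _≢_; refl; sym; trans; cong; subst₂; module ≡-Reasoning)
open import Algebra.Properties.CommutativeMonoid.Sum +-0-commutativeMonoid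
  using (sum; sum-syntax; sum-remove; sum-cong-≗; sum-replicate-zero; ∑-comm)

list-sum-tabulate : ∀ {n} (f : Fin n → ℕ) → List.sum (tabulate f) ≡ sum f
list-sum-tabulate {zero}  f = refl
list-sum-tabulate {suc n} f = cong (f zero +_) (list-sum-tabulate (f ∘ suc))

weight : Bool → ℕ
weight x = if x then 1 else 0

count-∑ : ∀ {n m} (X : Fin n → Fin m → Bool) →
  count X ≡ ∑[ i < n ] ∑[ j < m ] weight (X i j)
count-∑ {n} {m} X =
  trans (list-sum-allFin (λ i → List.sum (map (weight ∘ X i) (allFin m))))
        (sum-cong-≗ (λ i → list-sum-allFin (weight ∘ X i)))
  where
  list-sum-allFin : ∀ {k} (f : Fin k → ℕ) → List.sum (map f (allFin k)) ≡ sum f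
  list-sum-allFin f = trans (cong List.sum (map-tabulate id f)) (list-sum-tabulate f)

∑-mono : ∀ {n} {f g : Fin n → ℕ} → (∀ i → f i ≤ g i) → sum f ≤ sum g
∑-mono {zero}  f≤g = z≤n
∑-mono {suc n} f≤g = +-mono-≤ (f≤g zero) (∑-mono (f≤g ∘ suc))

∑-term : ∀ {n} (t : Fin n → ℕ) k → t k ≤ sum t
∑-term {suc n} t k = ≤-trans (m≤m+n (t k) _) (≤-reflexive (sym (sum-remove {i = k} t)))

∑-point : ∀ {n} (t : Fin n → ℕ) k → (∀ i → i ≢ k → t i ≡ 0) → sum t ≡ t k
∑-point {suc n} t k vanish = begin
  sum t                      ≡⟨ sum-remove {i = k} t ⟩
  t k + sum (t ∘ punchIn k)  ≡⟨ cong (t k +_) (sum-cong-≗ (λ j → vanish (punchIn k j) (punchInᵢ≢i k j))) ⟩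
  t k + sum {n} (λ _ → 0)    ≡⟨ cong (t k +_) (sum-replicate-zero n) ⟩
  t k + 0                    ≡⟨ +-identityʳ (t k) ⟩
  t k                        ∎
  where open ≡-Reasoning

select : ∀ {A} → Fin A → Fin A → ℕ → ℕ
select k i x = if does (k ≟ i) then x else 0

push : ∀ {N A} → (Fin N → Fin A) → (Fin N → ℕ) → Fin A → ℕ
push {N} φ h i = ∑[ r < N ] select (φ r) i (h r)

push-total : ∀ {N A} (φ : Fin N → Fin A) (h : Fin N → ℕ) → sum (push φ h) ≡ sum h
push-total {N} {A} φ h =
  trans (∑-comm (λ i r → select (φ r) i (h r))) (sum-cong-≗ fibre)
  where
  fibre : ∀ r → ∑[ i < A ] select (φ r) i (h r) ≡ h r
  fibre r = trans (∑-point _ (φ r) off) hit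
    where
    off : ∀ i → i ≢ φ r → select (φ r) i (h r) ≡ 0
    off i i≢φr rewrite dec-false (φ r ≟ i) (i≢φr ∘ sym) = refl
    hit : select (φ r) (φ r) (h r) ≡ h r
    hit rewrite dec-true (φ r ≟ φ r) refl = refl

push-point : ∀ {N A} (φ : Fin N → Fin A) (h : Fin N → ℕ) r → h r ≤ push φ h (φ r)
push-point φ h r = ≤-trans (≤-reflexive (sym hit)) (∑-term (λ s → select (φ s) (φ r) (h s)) r)
  where
  hit : select (φ r) (φ r) (h r) ≡ h r
  hit rewrite dec-true (φ r ≟ φ r) refl = refl

positive : ℕ → Bool
positive zero    = false
positive (suc _) = true

weight-positive : ∀ v → weight (positive v) ≤ v
weight-positive zero    = z≤n
weight-positive (suc v) = s≤s z≤n

fibreSize : ∀ {n m a b} → (Fin n → Fin a) → (Fin m → Fin b) →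
  (Fin n → Fin m → Bool) → Fin a → Fin b → ℕ
fibreSize φ ψ X i j = push φ (λ r → push ψ (weight ∘ X r) j) i

image : ∀ {n m a b} → (Fin n → Fin a) → (Fin m → Fin b) →
  (Fin n → Fin m → Bool) → Fin a → Fin b → Bool
image φ ψ X i j = positive (fibreSize φ ψ X i j)

image-hit : ∀ {n m a b} (φ : Fin n → Fin a) (ψ : Fin m → Fin b) X r c →
  X r c ≡ true → image φ ψ X (φ r) (ψ c) ≡ true
image-hit φ ψ X r c Xrc = positive-of (≤-trans one≤ (≤-trans inRow inColumn))
  where
  positive-of : ∀ {v} → 1 ≤ v → positive v ≡ true
  positive-of {suc v} _ = refl
  one≤ : 1 ≤ weight (X r c)
  one≤ rewrite Xrc = ≤-refl
  inRow : weight (X r c) ≤ push ψ (weight ∘ X r) (ψ c)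
  inRow = push-point ψ (weight ∘ X r) c
  inColumn : push ψ (weight ∘ X r) (ψ c) ≤ fibreSize φ ψ X (φ r) (ψ c)
  inColumn = push-point φ (λ s → push ψ (weight ∘ X s) (ψ c)) r

count-image : ∀ {n m a b} (φ : Fin n → Fin a) (ψ : Fin m → Fin b) X →
  count (image φ ψ X) ≤ count X
count-image {n} {m} {a} {b} φ ψ X = begin
  count (image φ ψ X)                           ≡⟨ count-∑ (image φ ψ X) ⟩
  ∑[ i < a ] ∑[ j < b ] weight (image φ ψ X i j) ≤⟨ ∑-mono (λ i → ∑-mono (λ j →
                                                      weight-positive (fibreSize φ ψ X i j))) ⟩
  ∑[ i < a ] ∑[ j < b ] fibreSize φ ψ X i j      ≡⟨ ∑-comm (fibreSize φ ψ X) ⟩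
  ∑[ j < b ] sum (λ i → fibreSize φ ψ X i j)    ≡⟨ sum-cong-≗ (λ j → push-total φ (λ r → column r j)) ⟩
  ∑[ j < b ] ∑[ r < n ] column r j               ≡⟨ ∑-comm column ⟨
  ∑[ r < n ] sum (column r)                     ≡⟨ sum-cong-≗ (λ r → push-total ψ (weight ∘ X r)) ⟩
  ∑[ r < n ] ∑[ c < m ] weight (X r c)           ≡⟨ count-∑ X ⟨
  count X                                       ∎
  where
  open ≤-Reasoning
  column : Fin n → Fin b → ℕ
  column r = push ψ (weight ∘ X r)

Near : ℕ → ℕ → Set
Near u v = u ≡ v ⊎ (u ≡ suc v ⊎ suc u ≡ v)

CloseTo : Pos → Pos → Set
CloseTo (r , c) (i , j) = (r ≡ i × Near c j) ⊎ (Near r i × c ≡ j)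

Blocked : ∀ {n m} → Config n m → Pos → Set
Blocked {n} {m} B (r , c) = Σ (r < n) λ p → Σ (c < m) λ q → B (fromℕ< p) (fromℕ< q) ≡ true

Guarded : ∀ {n m} → Config n m → Pos → Set
Guarded B p = Σ Pos λ q → Blocked B q × CloseTo q p

stopped : ∀ {n m} {B : Config n m} {q} → Reach B q → q ≡ (0 , 0) ⊎ Σ Dir λ d → Stuck B d q
stopped start              = inj₁ refl
stopped (move d _ sliding) = inj₂ (d , slide-end sliding)
  where
  slide-end : ∀ {B d p q} → Slide B d p q → Stuck B d q
  slide-end (stop stuck)       = stuck
  slide-end (step _ sliding)   = slide-end sliding

not-free⇒blocked : ∀ {n m} {B : Config n m} {r c} → r < n → c < m →
  ¬ Free B (r , c) → Blocked B (r , c)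
not-free⇒blocked {B = B} r<n c<m not-free with B (fromℕ< r<n) (fromℕ< c<m)
... | true  = r<n , c<m , refl
... | false with () ← not-free (r<n , c<m , refl)

lower-rows : ∀ {x n} → suc (suc x) < n → x < n × suc x < n
lower-rows {x} {n} h = ≤-trans (n≤1+n (suc x)) sx<n , sx<n
  where
  sx<n : suc x < n
  sx<n = ≤-trans (n≤1+n (suc (suc x))) h

interior-neighbour : ∀ {n m} d x y → suc (suc x) < n → suc (suc y) < m →
  Σ Pos λ q → next d (suc x , suc y) ≡ just q ×
    (proj₁ q < n × proj₂ q < m) × CloseTo q (suc x , suc y)
interior-neighbour d x y ssx<n ssy<m with lower-rows ssx<n | lower-rows ssy<m
... | x<n , sx<n | y<m , sy<m with d
... | up    = (x , suc y)           , refl , (x<n , sy<m)     , inj₂ (inj₂ (inj₂ refl) , refl)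
... | down  = (suc (suc x) , suc y) , refl , (ssx<n , sy<m)   , inj₂ (inj₂ (inj₁ refl) , refl)
... | left  = (suc x , y)           , refl , (sx<n , y<m)     , inj₁ (refl , inj₂ (inj₂ refl))
... | right = (suc x , suc (suc y)) , refl , (sx<n , ssy<m)   , inj₁ (refl , inj₂ (inj₁ refl))

-- In a solution every interior square is guarded: it is a block, or it is free,
-- hence reached, and the last slide was stopped by a blocked neighbour.
interior-guarded : ∀ {n m} {B : Config n m} → IsSolution n m B →
  ∀ x y → suc (suc x) < n → suc (suc y) < m → Guarded B (suc x , suc y)
interior-guarded {B = B} (_ , reached) x y ssx<n ssy<m
  with proj₂ (lower-rows ssx<n) | proj₂ (lower-rows ssy<m)
... | sx<n | sy<m with B (fromℕ< sx<n) (fromℕ< sy<m) in e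
... | true  = (suc x , suc y) , (sx<n , sy<m , e) , inj₁ (refl , inj₁ refl)
... | false with stopped (reached (suc x , suc y) (sx<n , sy<m , e))
... | inj₁ ()
... | inj₂ (d , stuck) with interior-neighbour d x y ssx<n ssy<m
... | q , step-d , (r<n , c<m) , close =
  q , not-free⇒blocked {B = B} r<n c<m (stuck q step-d) , close

shrink : ℕ → ℕ → ℕ
shrink a r = pred r ⊓ a

shrink-< : ∀ a r → shrink a r < suc a
shrink-< a r = s≤s (m⊓n≤n (pred r) a)

shrink-interior : ∀ {a x} → x ≤ a → shrink a (suc x) ≡ x
shrink-interior = m≤n⇒m⊓n≡m

shrink-near : ∀ {a x r} → x ≤ a → Near r (suc x) → Near (shrink a r) x
shrink-near x≤a (inj₁ refl) = inj₁ (shrink-interior x≤a)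
shrink-near {a} {x} x≤a (inj₂ (inj₁ refl)) with suc x ≤? a
... | yes sx≤a = inj₂ (inj₁ (m≤n⇒m⊓n≡m sx≤a))
... | no  sx≰a = inj₁ (trans (m≥n⇒m⊓n≡n (≤-trans a≤x (n≤1+n x))) (≤-antisym a≤x x≤a))
  where
  a≤x = ≤-pred (≰⇒> sx≰a)
shrink-near {x = zero}  x≤a (inj₂ (inj₂ refl)) = inj₁ refl
shrink-near {x = suc z} x≤a (inj₂ (inj₂ refl)) =
  inj₂ (inj₂ (cong suc (shrink-interior (≤-trans (n≤1+n z) x≤a))))

shrink-close : ∀ {a b x y r c} → x ≤ a → y ≤ b → CloseTo (r , c) (suc x , suc y) →
  CloseTo (shrink a r , shrink b c) (x , y)
shrink-close x≤a y≤b (inj₁ (refl , near)) = inj₁ (shrink-interior x≤a , shrink-near y≤b near)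
shrink-close x≤a y≤b (inj₂ (near , refl)) = inj₂ (shrink-near x≤a near , shrink-interior y≤b)

squeeze : ∀ {N} a → Fin N → Fin (suc a)
squeeze a r = fromℕ< (shrink-< a (toℕ r))

toℕ-squeeze : ∀ {N} a {r} (r<N : r < N) → toℕ (squeeze a (fromℕ< r<N)) ≡ shrink a r
toℕ-squeeze a {r} r<N = trans (toℕ-fromℕ< _) (cong (shrink a) (toℕ-fromℕ< r<N))

close⇒dominated : ∀ {a b} (D : Fin a → Fin b → Bool) {i' i j' j} → D i' j' ≡ true →
  CloseTo (toℕ i' , toℕ j') (toℕ i , toℕ j) →
  (D i j ≡ true) ⊎ (Σ (Fin a) λ i'' → Σ (Fin b) λ j'' → D i'' j'' ≡ true × GridAdj (i'' , j'') (i , j))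
close⇒dominated D d (inj₁ (i'≡i , inj₁ j'≡j)) =
  inj₁ (subst₂ (λ k l → D k l ≡ true) (toℕ-injective i'≡i) (toℕ-injective j'≡j) d)
close⇒dominated D {i'} {_} {j'} d (inj₁ (i'≡i , inj₂ adjacent)) =
  inj₂ (i' , j' , d , inj₁ (i'≡i , adjacent))
close⇒dominated D d (inj₂ (inj₁ i'≡i , j'≡j)) =
  inj₁ (subst₂ (λ k l → D k l ≡ true) (toℕ-injective i'≡i) (toℕ-injective j'≡j) d)
close⇒dominated D {i'} {_} {j'} d (inj₂ (inj₂ adjacent , j'≡j)) =
  inj₂ (i' , j' , d , inj₂ (j'≡j , adjacent))

projection-dominates : ∀ a b (B : Config (3 + a) (3 + b)) → IsSolution _ _ B →
  IsDominating (suc a) (suc b) (image (squeeze a) (squeeze b) B)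
projection-dominates a b B solution i j
  with interior-guarded solution (toℕ i) (toℕ j) (s≤s (s≤s (toℕ<n i))) (s≤s (s≤s (toℕ<n j)))
... | (r , c) , (r<n , c<m , block) , close =
  close⇒dominated (image (squeeze a) (squeeze b) B) (image-hit (squeeze a) (squeeze b) B _ _ block)
    (subst₂ (λ u v → CloseTo (u , v) (toℕ i , toℕ j))
      (sym (toℕ-squeeze a r<n)) (sym (toℕ-squeeze b c<m))
      (shrink-close (≤-pred (toℕ<n i)) (≤-pred (toℕ<n j)) close))

mainTheorem8 : ∀ (n m : ℕ) → 3 ≤ m → m ≤ n →
    ∀ (k g : ℕ) → IsOptBS n m k → IsDominationNumber (n ∸ 2) (m ∸ 2) g → g ≤ k
mainTheorem8 (suc (suc (suc a))) (suc (suc (suc b))) (s≤s (s≤s (s≤s _))) (s≤s (s≤s (s≤s _)))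
  k g ((B , solution , refl) , _) (_ , minimal) =
  ≤-trans (minimal _ (projection-dominates a b B solution))
          (count-image (squeeze a) (squeeze b) B)
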